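{- Let $n\ge 1$ and $I=\{i_1<\dots<i_l\}\subseteq\{0,\dots,n-1\}$, and set $i_{l+1}=n$. Let $j_t=i_{t+1}-i_t$ for $1\le t\le l$. If there exists $m\in\{1,\dots,l\}$ with $j_m$ odd, let $m$ be the largest such index; then $$f_{n,I}(X)=-X^n f_{n-1,I^{(m+1)}}(X)+\sum_{t=m}^{l}X^{n-i_{t+1}}f_{n-1,I^{(t+1)}}(X).$$ If no such $m$ exists, then $$f_{n,I}(X)=\sum_{t=0}^{l}X^{n-i_{t+1}}f_{n-1,I^{(t+1)}}(X).$$
   Context: Polynomials in $X$: $(\underline{k})=1-X^k$ for $k>0$, $(\underline 0)=1$; $(\underline{k})!=\prod_{i=1}^k(\underline i)$; $(\underline k)!!=\prod_{1\le i\le k,\ i\text{ even}}(\underline i)$. For an integer $N\ge0$ and a finite set of integers $K=\{k_1<\dots<k_l\}$ with $l\ge1$ and $k_l\le N$: if $k_1<0$ set $f_{N,K}=0$; otherwise, with $d_t=k_{t+1}-k_t$ ($1\le t<l$) and $d_l=N-k_l$, set $f_{N,K}(X)=\frac{(\underline N)!}{(\underline{k_1})!\prod_{t=1}^l(\underline{d_t})!!}$. Also $f_{N,\emptyset}=1$. For $k\in\{1,\dots,l+1\}$ define $I^{(k)}$ by: $I^{(l+1)}=I$; for $k\le l$, if $k=1$ or $i_k-1\ne i_{k-1}$ then $I^{(k)}=\{i_1,\dots,i_{k-1},i_k-1,\dots,i_l-1\}$, and otherwise $I^{(k)}=\{i_1,\dots,i_{k-2},i_k-1,\dots,i_l-1\}$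 (the repeated value is listed once). -}

module Defs where

open import Data.Nat as ℕ using (ℕ; zero; suc; _∸_; _<_; _≤_; ⌊_/2⌋)
open import Data.Integer as ℤ using (ℤ; +_; -[1+_]; 0ℤ; 1ℤ; -1ℤ; ∣_∣)
open import Data.List using (List; []; _∷_; map; foldr; upTo; take; drop; reverse; _++_)
open import Data.Bool using (Bool; true; false; if_then_else_)
open import Data.Product using (∃)
open import Relation.Nullary using (does)
open import Relation.Binary.PropositionalEquality using (_≡_)

-- Polynomials in X over ℤ, as coefficient lists (lowest degree first).

Poly : Set
Poly = List ℤ

infixl 6 _+P_
infixl 7 _*P_

_+P_ : Poly → Poly → Poly
[] +P q = q
(a ∷ p) +P [] = a ∷ p
(a ∷ p) +P (b ∷ q) = (a ℤ.+ b) ∷ (p +P q)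

scaleP : ℤ → Poly → Poly
scaleP a = map (a ℤ.*_)

_*P_ : Poly → Poly → Poly
[] *P q = []
(a ∷ p) *P q = scaleP a q +P (0ℤ ∷ (p *P q))

negP : Poly → Poly
negP = scaleP -1ℤ

oneP : Poly
oneP = 1ℤ ∷ []

Xpow : ℕ → Poly
Xpow zero = oneP
Xpow (suc k) = 0ℤ ∷ Xpow k

coeff : Poly → ℕ → ℤ
coeff [] i = 0ℤ
coeff (a ∷ p) zero = a
coeff (a ∷ p) (suc i) = coeff p i

-- equality of polynomials (coefficientwise; trailing zeros irrelevant)
infix 4 _≈P_
_≈P_ : Poly → Poly → Set
p ≈P q = ∀ i → coeff p i ≡ coeff q i

prodP : List Poly → Poly
prodP = foldr _*P_ oneP

-- (k) = 1 - X^k for k > 0, (0) = 1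
u : ℕ → Poly
u zero = oneP
u (suc k) = oneP +P negP (Xpow (suc k))

fact : ℕ → Poly
fact k = prodP (map (λ i → u (suc i)) (upTo k))

-- (k)!! = ∏_{1 ≤ i ≤ k, i even} (i) = ∏_{s=1}^{⌊k/2⌋} (2s)
dfact : ℕ → Poly
dfact k = prodP (map (λ s → u (suc s ℕ.+ suc s)) (upTo ⌊ k /2⌋))

-- Rational functions: formal fractions num / den in ℤ(X).
-- (All denominators arising below are products of nonzero (k)'s.)

record RatFun : Set where
  constructor _/_
  field
    num : Poly
    den : Poly
open RatFun public

infix 4 _≈F_
_≈F_ : RatFun → RatFun → Set
(a / b) ≈F (c / d) = a *P d ≈P c *P b

infixl 6 _+F_
_+F_ : RatFun → RatFun → RatFun
(a / b) +F (c / d) = (a *P d +P c *P b) / (b *P d)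

infixl 7 _·F_
_·F_ : Poly → RatFun → RatFun
p ·F (a / b) = (p *P a) / b

zeroF : RatFun
zeroF = [] / oneP

sumF : ℕ → ℕ → (ℕ → RatFun) → RatFun
sumF a b g = foldr _+F_ zeroF (map (λ s → g (a ℕ.+ s)) (upTo (suc b ∸ a)))

-- f_{N,K} for K = {k₁ < … < k_l} given as a strictly increasing list of integers.

-- ∏_t (d_t)!!  with d_t = k_{t+1} - k_t, d_l = N - k_l ; first arg is current k_t
dfacts : ℕ → ℤ → List ℤ → Poly
dfacts N k [] = dfact (N ∸ ∣ k ∣)
dfacts N k (k' ∷ ks) = dfact ∣ k' ℤ.- k ∣ *P dfacts N k' ks

f : ℕ → List ℤ → RatFun
f N [] = oneP / oneP
f N (-[1+ _ ] ∷ ks) = zeroF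
f N (+ a ∷ ks) = fact N / (fact a *P dfacts N (+ a) ks)

-- I^{(k)} for I = {i₁ < … < i_l} (list of naturals), 1 ≤ k ≤ l+1.

shift1 : ℕ → ℤ
shift1 i = + i ℤ.- 1ℤ

-- arguments: reversed prefix (i_{k-1}, …, i_1), suffix (i_k, …, i_l)
mergeI : List ℕ → List ℕ → List ℤ
mergeI (g ∷ rpre) (h ∷ post) =
  if does (suc g ℕ.≟ h)
  then map +_ (reverse rpre) ++ map shift1 (h ∷ post)
  else map +_ (reverse (g ∷ rpre)) ++ map shift1 (h ∷ post)
mergeI rpre post = map +_ (reverse rpre) ++ map shift1 post

Isup : List ℕ → ℕ → List ℤ
Isup I k = mergeI (reverse (take (k ∸ 1) I)) (drop (k ∸ 1) I)

-- i_t (1-based), with i_{l+1} = n ; j_t = i_{t+1} - i_t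

iAt : List ℕ → ℕ → ℕ → ℕ
iAt [] n t = n
iAt (x ∷ xs) n zero = 0          -- unused junk value
iAt (x ∷ xs) n (suc zero) = x
iAt (x ∷ xs) n (suc (suc t)) = iAt xs n (suc t)

jAt : List ℕ → ℕ → ℕ → ℕ
jAt I n t = iAt I n (suc t) ∸ iAt I n t

Odd : ℕ → Set
Odd j = ∃ λ k → j ≡ suc (k ℕ.+ k)

term : List ℕ → ℕ → ℕ → RatFun
term I n t = Xpow (n ∸ iAt I n (suc t)) ·F f (n ∸ 1) (Isup I (suc t))

-- Each summand is a polynomial multiple of f_{n,I}/(n).  Passing from I to I^{(t+1)} lowers the
-- gap j_t by one and leaves i₁ and the other gaps alone, so f_{n-1,I^{(t+1)}} is f_{n,I}/(n) times
-- (j_t)!!/(j_t - 1)!!, which is (j_t) for even j_t and 1 for odd j_t; for t = 0 every element drops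
-- by one and the factor is (i₁) (zero when i₁ = 0).  Multiplied by X^{n-i_{t+1}}, an even summand
-- becomes X^{n-i_{t+1}} - X^{n-i_t} and an odd one X^{n-i_{t+1}}.  Hence the sum telescopes to
-- (1 - X^n) f_{n,I}/(n) = f_{n,I}; in the odd case the summand t = m, together with the extra term
-- -X^n f_{n-1,I^{(m+1)}}, contributes X^{n-i_{m+1}} - X^n, replacing the summands before m.
-- All identities are cross-multiplied, so no division of polynomials is needed.

module Submission where

open import Defs
open import Data.Nat as ℕ using (ℕ; zero; suc; _∸_; _<_; _≤_; z≤n; s≤s; ⌊_/2⌋)
import Data.Nat.Properties as ℕP
open import Data.Integer as ℤ using (ℤ; +_; 0ℤ; 1ℤ; -1ℤ; ∣_∣)
import Data.Integer.Properties as ℤP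
open import Data.List using (List; []; _∷_; map; foldr; upTo; applyUpTo; reverse; take; drop; _++_; _∷ʳ_; length)
import Data.List.Properties as List
open import Data.List.Relation.Unary.All as All using (All; []; _∷_)
open import Data.List.Relation.Unary.Linked using (Linked; _∷_)
open import Data.List.Relation.Unary.Linked.Properties using (Linked⇒All)
open import Data.Bool using (true; false)
open import Data.Maybe using (Maybe; just; nothing)
open import Data.Product using (_×_; _,_; ∃; ∃₂)
open import Data.Sum using (_⊎_; inj₁; inj₂)
open import Data.Empty using (⊥-elim)
open import Level using (0ℓ)
open import Relation.Nullary using (¬_; Dec; yes; no; does)
open import Relation.Nullary.Decidable using (dec-true; dec-false)
open import Relation.Binary.Bundles using (Setoid)
open import Relation.Binary.Structures using (IsEquivalence)
open import Relation.Binary.PropositionalEquality using (_≡_; _≢_; refl; sym; trans; cong; cong₂; subst)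
open import Algebra.Bundles using (CommutativeRing; CommutativeSemigroup)
open import Algebra.Solver.Ring.AlmostCommutativeRing using (fromCommutativeRing; _-Raw-AlmostCommutative⟶_)

-- The ring of polynomials

-- Coefficientwise equality, wrapped in a record so that its two indices can be inferred.
infix 4 _≋_
record _≋_ (p q : Poly) : Set where
  constructor mk≋
  field coeff-≡ : p ≈P q
open _≋_

≋-refl : ∀ {p} → p ≋ p
≋-refl = mk≋ λ _ → refl

≋-reflexive : ∀ {p q} → p ≡ q → p ≋ q
≋-reflexive refl = ≋-refl

≋-sym : ∀ {p q} → p ≋ q → q ≋ p
≋-sym (mk≋ e) = mk≋ λ i → sym (e i)

≋-trans : ∀ {p q r} → p ≋ q → q ≋ r → p ≋ r
≋-trans (mk≋ e) (mk≋ e′) = mk≋ λ i → trans (e i) (e′ i)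

≋-isEquivalence : IsEquivalence _≋_
≋-isEquivalence = record { refl = ≋-refl ; sym = ≋-sym ; trans = ≋-trans }

≋-setoid : Setoid 0ℓ 0ℓ
≋-setoid = record { isEquivalence = ≋-isEquivalence }

open import Relation.Binary.Reasoning.Setoid ≋-setoid

∷-cong : ∀ {a b p q} → a ≡ b → p ≋ q → a ∷ p ≋ b ∷ q
∷-cong a≡b (mk≋ e) = mk≋ λ { zero → a≡b ; (suc i) → e i }

∷-head : ∀ {a b p q} → a ∷ p ≋ b ∷ q → a ≡ b
∷-head (mk≋ e) = e zero

∷-tail : ∀ {a b p q} → a ∷ p ≋ b ∷ q → p ≋ q
∷-tail (mk≋ e) = mk≋ λ i → e (suc i)

∷-≋[] : ∀ {a p} → a ≡ 0ℤ → p ≋ [] → a ∷ p ≋ []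
∷-≋[] a≡0 (mk≋ e) = mk≋ λ { zero → a≡0 ; (suc i) → e i }

∷-≋[]-head : ∀ {a p} → a ∷ p ≋ [] → a ≡ 0ℤ
∷-≋[]-head (mk≋ e) = e zero

∷-≋[]-tail : ∀ {a p} → a ∷ p ≋ [] → p ≋ []
∷-≋[]-tail (mk≋ e) = mk≋ λ i → e (suc i)

coeff-+P : ∀ p q i → coeff (p +P q) i ≡ coeff p i ℤ.+ coeff q i
coeff-+P []      q       i       = sym (ℤP.+-identityˡ _)
coeff-+P (a ∷ p) []      i       = sym (ℤP.+-identityʳ _)
coeff-+P (a ∷ p) (b ∷ q) zero    = refl
coeff-+P (a ∷ p) (b ∷ q) (suc i) = coeff-+P p q i

coeff-scaleP : ∀ a p i → coeff (scaleP a p) i ≡ a ℤ.* coeff p i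
coeff-scaleP a []      i       = sym (ℤP.*-zeroʳ a)
coeff-scaleP a (b ∷ p) zero    = refl
coeff-scaleP a (b ∷ p) (suc i) = coeff-scaleP a p i

+P-cong : ∀ {p p′ q q′} → p ≋ p′ → q ≋ q′ → p +P q ≋ p′ +P q′
+P-cong {p} {p′} {q} {q′} (mk≋ e) (mk≋ e′) = mk≋ λ i →
  trans (coeff-+P p q i) (trans (cong₂ ℤ._+_ (e i) (e′ i)) (sym (coeff-+P p′ q′ i)))

scaleP-cong : ∀ a {p q} → p ≋ q → scaleP a p ≋ scaleP a q
scaleP-cong a {p} {q} (mk≋ e) = mk≋ λ i →
  trans (coeff-scaleP a p i) (trans (cong (a ℤ.*_) (e i)) (sym (coeff-scaleP a q i)))

+P-identityʳ : ∀ p → p +P [] ≡ p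
+P-identityʳ []      = refl
+P-identityʳ (a ∷ p) = refl

+P-comm : ∀ p q → p +P q ≋ q +P p
+P-comm []      []      = ≋-refl
+P-comm []      (b ∷ q) = ≋-refl
+P-comm (a ∷ p) []      = ≋-refl
+P-comm (a ∷ p) (b ∷ q) = ∷-cong (ℤP.+-comm a b) (+P-comm p q)

+P-assoc : ∀ p q r → (p +P q) +P r ≋ p +P (q +P r)
+P-assoc []      q       r       = ≋-refl
+P-assoc (a ∷ p) []      r       = ≋-refl
+P-assoc (a ∷ p) (b ∷ q) []      = ≋-refl
+P-assoc (a ∷ p) (b ∷ q) (c ∷ r) = ∷-cong (ℤP.+-assoc a b c) (+P-assoc p q r)

negP-inverseˡ : ∀ p → negP p +P p ≋ []
negP-inverseˡ []      = ≋-refl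
negP-inverseˡ (a ∷ p) =
  ∷-≋[] (trans (cong (ℤ._+ a) (ℤP.-1*i≡-i a)) (ℤP.+-inverseˡ a)) (negP-inverseˡ p)

negP-inverseʳ : ∀ p → p +P negP p ≋ []
negP-inverseʳ p = ≋-trans (+P-comm p (negP p)) (negP-inverseˡ p)

scaleP-distribˡ : ∀ a p q → scaleP a (p +P q) ≋ scaleP a p +P scaleP a q
scaleP-distribˡ a []      q       = ≋-refl
scaleP-distribˡ a (b ∷ p) []      = ≋-refl
scaleP-distribˡ a (b ∷ p) (c ∷ q) = ∷-cong (ℤP.*-distribˡ-+ a b c) (scaleP-distribˡ a p q)

scaleP-distribʳ : ∀ a b p → scaleP (a ℤ.+ b) p ≋ scaleP a p +P scaleP b p
scaleP-distribʳ a b []      = ≋-refl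
scaleP-distribʳ a b (c ∷ p) = ∷-cong (ℤP.*-distribʳ-+ c a b) (scaleP-distribʳ a b p)

scaleP-assoc : ∀ a b p → scaleP a (scaleP b p) ≋ scaleP (a ℤ.* b) p
scaleP-assoc a b []      = ≋-refl
scaleP-assoc a b (c ∷ p) = ∷-cong (sym (ℤP.*-assoc a b c)) (scaleP-assoc a b p)

scaleP-zero : ∀ p → scaleP 0ℤ p ≋ []
scaleP-zero []      = ≋-refl
scaleP-zero (a ∷ p) = ∷-≋[] refl (scaleP-zero p)

scaleP-identity : ∀ p → scaleP 1ℤ p ≋ p
scaleP-identity []      = ≋-refl
scaleP-identity (a ∷ p) = ∷-cong (ℤP.*-identityˡ a) (scaleP-identity p)

+P-commutativeSemigroup : CommutativeSemigroup 0ℓ 0ℓ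
+P-commutativeSemigroup = record
  { _∙_ = _+P_
  ; isCommutativeSemigroup = record
    { isSemigroup = record
      { isMagma = record { isEquivalence = ≋-isEquivalence ; ∙-cong = +P-cong }
      ; assoc = +P-assoc }
    ; comm = +P-comm } }

open import Algebra.Properties.CommutativeSemigroup +P-commutativeSemigroup
  using () renaming (interchange to +P-interchange; x∙yz≈y∙xz to +P-swapˡ)

*P-zeroˡ : ∀ {p} q → p ≋ [] → p *P q ≋ []
*P-zeroˡ {[]}    q p≋[] = ≋-refl
*P-zeroˡ {a ∷ p} q p≋[] = +P-cong
  (≋-trans (≋-reflexive (cong (λ c → scaleP c q) (∷-≋[]-head p≋[]))) (scaleP-zero q))
  (∷-≋[] refl (*P-zeroˡ q (∷-≋[]-tail p≋[])))

*P-zeroʳ : ∀ p → p *P [] ≋ []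
*P-zeroʳ []      = ≋-refl
*P-zeroʳ (a ∷ p) = ∷-≋[] refl (*P-zeroʳ p)

*P-congʳ : ∀ {p p′} q → p ≋ p′ → p *P q ≋ p′ *P q
*P-congʳ {[]}    {p′}     q e = ≋-sym (*P-zeroˡ q (≋-sym e))
*P-congʳ {a ∷ p} {[]}     q e = *P-zeroˡ q e
*P-congʳ {a ∷ p} {b ∷ p′} q e =
  +P-cong (≋-reflexive (cong (λ c → scaleP c q) (∷-head e))) (∷-cong refl (*P-congʳ q (∷-tail e)))

*P-distribʳ : ∀ q p p′ → (p +P p′) *P q ≋ p *P q +P p′ *P q
*P-distribʳ q []      p′       = ≋-refl
*P-distribʳ q (a ∷ p) []       = ≋-reflexive (sym (+P-identityʳ _))
*P-distribʳ q (a ∷ p) (b ∷ p′) = begin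
  scaleP (a ℤ.+ b) q +P (0ℤ ∷ (p +P p′) *P q)
    ≈⟨ +P-cong (scaleP-distribʳ a b q) (∷-cong refl (*P-distribʳ q p p′)) ⟩
  (scaleP a q +P scaleP b q) +P ((0ℤ ∷ p *P q) +P (0ℤ ∷ p′ *P q))
    ≈⟨ +P-interchange (scaleP a q) (scaleP b q) (0ℤ ∷ p *P q) (0ℤ ∷ p′ *P q) ⟩
  (scaleP a q +P (0ℤ ∷ p *P q)) +P (scaleP b q +P (0ℤ ∷ p′ *P q)) ∎

*P-distribˡ : ∀ p q q′ → p *P (q +P q′) ≋ p *P q +P p *P q′
*P-distribˡ []      q q′ = ≋-refl
*P-distribˡ (a ∷ p) q q′ = begin
  scaleP a (q +P q′) +P (0ℤ ∷ p *P (q +P q′))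
    ≈⟨ +P-cong (scaleP-distribˡ a q q′) (∷-cong refl (*P-distribˡ p q q′)) ⟩
  (scaleP a q +P scaleP a q′) +P ((0ℤ ∷ p *P q) +P (0ℤ ∷ p *P q′))
    ≈⟨ +P-interchange (scaleP a q) (scaleP a q′) (0ℤ ∷ p *P q) (0ℤ ∷ p *P q′) ⟩
  (scaleP a q +P (0ℤ ∷ p *P q)) +P (scaleP a q′ +P (0ℤ ∷ p *P q′)) ∎

*P-∷ʳ : ∀ p b q → p *P (b ∷ q) ≋ scaleP b p +P (0ℤ ∷ p *P q)
*P-∷ʳ []      b q = ≋-sym (∷-≋[] refl ≋-refl)
*P-∷ʳ (a ∷ p) b q = ∷-cong (cong (ℤ._+ 0ℤ) (ℤP.*-comm a b))
  (≋-trans (+P-cong (≋-refl {scaleP a q}) (*P-∷ʳ p b q)) (+P-swapˡ (scaleP a q) (scaleP b p) _))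

*P-comm : ∀ p q → p *P q ≋ q *P p
*P-comm []      q = ≋-sym (*P-zeroʳ q)
*P-comm (a ∷ p) q = ≋-trans (+P-cong (≋-refl {scaleP a q}) (∷-cong refl (*P-comm p q))) (≋-sym (*P-∷ʳ q a p))

scaleP-*P : ∀ a p q → scaleP a (p *P q) ≋ scaleP a p *P q
scaleP-*P a []      q = ≋-refl
scaleP-*P a (b ∷ p) q = begin
  scaleP a (scaleP b q +P (0ℤ ∷ p *P q))           ≈⟨ scaleP-distribˡ a (scaleP b q) (0ℤ ∷ p *P q) ⟩
  scaleP a (scaleP b q) +P (a ℤ.* 0ℤ ∷ scaleP a (p *P q))
    ≈⟨ +P-cong (scaleP-assoc a b q) (∷-cong (ℤP.*-zeroʳ a) (scaleP-*P a p q)) ⟩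
  scaleP (a ℤ.* b) q +P (0ℤ ∷ scaleP a p *P q)     ∎

*P-assoc : ∀ p q r → (p *P q) *P r ≋ p *P (q *P r)
*P-assoc []      q r = ≋-refl
*P-assoc (a ∷ p) q r = begin
  (scaleP a q +P (0ℤ ∷ p *P q)) *P r             ≈⟨ *P-distribʳ r (scaleP a q) (0ℤ ∷ p *P q) ⟩
  scaleP a q *P r +P (scaleP 0ℤ r +P (0ℤ ∷ (p *P q) *P r))
    ≈⟨ +P-cong (≋-sym (scaleP-*P a q r)) (+P-cong (scaleP-zero r) (∷-cong refl (*P-assoc p q r))) ⟩
  scaleP a (q *P r) +P (0ℤ ∷ p *P (q *P r))      ∎

*P-identityˡ : ∀ p → oneP *P p ≋ p
*P-identityˡ p = ≋-trans (+P-cong (scaleP-identity p) (∷-≋[] refl ≋-refl)) (≋-reflexive (+P-identityʳ p))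

*P-identityʳ : ∀ p → p *P oneP ≋ p
*P-identityʳ p = ≋-trans (*P-comm p oneP) (*P-identityˡ p)

*P-cong : ∀ {p p′ q q′} → p ≋ p′ → q ≋ q′ → p *P q ≋ p′ *P q′
*P-cong {p} {p′} {q} {q′} e e′ = begin
  p *P q   ≈⟨ *P-congʳ q e ⟩
  p′ *P q  ≈⟨ *P-comm p′ q ⟩
  q *P p′  ≈⟨ *P-congʳ p′ e′ ⟩
  q′ *P p′ ≈⟨ *P-comm q′ p′ ⟩
  p′ *P q′ ∎

Poly-commutativeRing : CommutativeRing 0ℓ 0ℓ
Poly-commutativeRing = record
  { _+_ = _+P_ ; _*_ = _*P_ ; -_ = negP ; 0# = [] ; 1# = oneP
  ; isCommutativeRing = record
    { isRing = record
      { +-isAbelianGroup = record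
        { isGroup = record
          { isMonoid = record
            { isSemigroup = CommutativeSemigroup.isSemigroup +P-commutativeSemigroup
            ; identity = (λ _ → ≋-refl) , λ p → ≋-reflexive (+P-identityʳ p) }
          ; inverse = negP-inverseˡ , negP-inverseʳ
          ; ⁻¹-cong = scaleP-cong -1ℤ }
        ; comm = +P-comm }
      ; *-cong = *P-cong
      ; *-assoc = *P-assoc
      ; *-identity = *P-identityˡ , *P-identityʳ
      ; distrib = *P-distribˡ , *P-distribʳ }
    ; *-comm = *P-comm } }

constP : ℤ → Poly
constP a = a ∷ []

constP-homomorphism : CommutativeRing.rawRing ℤP.+-*-commutativeRing
                        -Raw-AlmostCommutative⟶ fromCommutativeRing Poly-commutativeRing
constP-homomorphism = record
  { ⟦_⟧    = constP
  ; +-homo = λ _ _ → ≋-refl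
  ; *-homo = λ a b → ∷-cong (sym (ℤP.+-identityʳ _)) ≋-refl
  ; -‿homo = λ a → ∷-cong (sym (ℤP.-1*i≡-i a)) ≋-refl
  ; 0-homo = ∷-≋[] refl ≋-refl
  ; 1-homo = ≋-refl }

constP-≟ : ∀ a b → Maybe (constP a ≋ constP b)
constP-≟ a b with a ℤP.≟ b
... | yes refl = just ≋-refl
... | no _     = nothing

open import Algebra.Solver.Ring (CommutativeRing.rawRing ℤP.+-*-commutativeRing)
  (fromCommutativeRing Poly-commutativeRing) constP-homomorphism constP-≟
  using (solve; _:=_; _:+_; _:*_; _:-_; :-_; con)

*P-swapˡ : ∀ a b c → a *P (b *P c) ≋ b *P (a *P c)
*P-swapˡ = solve 3 (λ a b c → a :* (b :* c) := b :* (a :* c)) ≋-refl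

-- Factorials and double factorials

prodP-++ : ∀ ps qs → prodP (ps ++ qs) ≋ prodP ps *P prodP qs
prodP-++ []       qs = ≋-sym (*P-identityˡ (prodP qs))
prodP-++ (p ∷ ps) qs = ≋-trans (*P-cong (≋-refl {p}) (prodP-++ ps qs)) (≋-sym (*P-assoc p (prodP ps) (prodP qs)))

prodP-upTo-suc : ∀ (g : ℕ → Poly) k → prodP (map g (upTo (suc k))) ≋ g k *P prodP (map g (upTo k))
prodP-upTo-suc g k = begin
  prodP (map g (upTo (suc k)))            ≡⟨ cong (λ xs → prodP (map g xs)) (sym (List.upTo-∷ʳ k)) ⟩
  prodP (map g (upTo k ∷ʳ k))             ≡⟨ cong prodP (List.map-++ g (upTo k) (k ∷ [])) ⟩
  prodP (map g (upTo k) ++ (g k ∷ []))    ≈⟨ prodP-++ (map g (upTo k)) (g k ∷ []) ⟩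
  prodP (map g (upTo k)) *P (g k *P oneP) ≈⟨ *P-cong (≋-refl {prodP (map g (upTo k))}) (*P-identityʳ (g k)) ⟩
  prodP (map g (upTo k)) *P g k           ≈⟨ *P-comm (prodP (map g (upTo k))) (g k) ⟩
  g k *P prodP (map g (upTo k))           ∎

fact-suc : ∀ k → fact (suc k) ≋ u (suc k) *P fact k
fact-suc = prodP-upTo-suc (λ i → u (suc i))

fact-unfold : ∀ {n} → 1 ≤ n → fact n ≋ (oneP +P negP (Xpow n)) *P fact (n ∸ 1)
fact-unfold {suc n} _ = fact-suc n

evenFactor : ℕ → Poly
evenFactor s = u (suc s ℕ.+ suc s)

-- dfact j is definitionally evenProd ⌊ j /2⌋
evenProd : ℕ → Poly
evenProd h = prodP (map evenFactor (upTo h))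

⌊1+n+n/2⌋≡n : ∀ n → ⌊ suc (n ℕ.+ n) /2⌋ ≡ n
⌊1+n+n/2⌋≡n zero    = refl
⌊1+n+n/2⌋≡n (suc n) = trans (cong (λ m → suc ⌊ m /2⌋) (ℕP.+-suc n n)) (cong suc (⌊1+n+n/2⌋≡n n))

parity : ∀ j → (∃ λ q → j ≡ q ℕ.+ q) ⊎ Odd j
parity zero    = inj₁ (0 , refl)
parity (suc j) with parity j
... | inj₁ (q , j≡q+q) = inj₂ (q , cong suc j≡q+q)
... | inj₂ (q , j≡1+q+q) = inj₁ (suc q , cong suc (trans j≡1+q+q (sym (ℕP.+-suc q q))))

dfact-odd : ∀ {j} → Odd j → dfact j ≡ dfact (j ∸ 1)
dfact-odd (q , refl) = cong evenProd (trans (⌊1+n+n/2⌋≡n q) (ℕP.n≡⌊n+n/2⌋ q))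

dfact-even : ∀ {j} → 1 ≤ j → ¬ Odd j → dfact j ≋ u j *P dfact (j ∸ 1)
dfact-even {j} 1≤j ¬odd with parity j
... | inj₂ odd            = ⊥-elim (¬odd odd)
... | inj₁ (zero , refl)  = ⊥-elim (ℕP.<-irrefl refl 1≤j)
... | inj₁ (suc q , refl) = begin
  evenProd ⌊ suc q ℕ.+ suc q /2⌋         ≡⟨ cong evenProd (sym (ℕP.n≡⌊n+n/2⌋ (suc q))) ⟩
  evenProd (suc q)                       ≈⟨ prodP-upTo-suc evenFactor q ⟩
  evenFactor q *P evenProd q             ≡⟨ cong (λ h → evenFactor q *P evenProd h) (sym ⌊q+1+q/2⌋≡q) ⟩
  evenFactor q *P evenProd ⌊ q ℕ.+ suc q /2⌋ ∎
  where
  ⌊q+1+q/2⌋≡q : ⌊ q ℕ.+ suc q /2⌋ ≡ q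
  ⌊q+1+q/2⌋≡q = trans (cong ⌊_/2⌋ (ℕP.+-suc q q)) (⌊1+n+n/2⌋≡n q)

Xpow-+ : ∀ a b → Xpow a *P Xpow b ≋ Xpow (a ℕ.+ b)
Xpow-+ zero    b = *P-identityˡ (Xpow b)
Xpow-+ (suc a) b = +P-cong (scaleP-zero (Xpow b)) (∷-cong refl (Xpow-+ a b))

Xpow-*-u : ∀ a {b} → 1 ≤ b → Xpow a *P u b ≋ Xpow a +P negP (Xpow (a ℕ.+ b))
Xpow-*-u a {suc b} _ = begin
  Xpow a *P (oneP +P negP (Xpow (suc b)))
    ≈⟨ solve 2 (λ x y → x :* (con 1ℤ :- y) := x :- x :* y) ≋-refl (Xpow a) (Xpow (suc b)) ⟩
  Xpow a +P negP (Xpow a *P Xpow (suc b))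
    ≈⟨ +P-cong (≋-refl {Xpow a}) (scaleP-cong -1ℤ (Xpow-+ a (suc b))) ⟩
  Xpow a +P negP (Xpow (a ℕ.+ suc b))                ∎

-- The sets I^{(k)} and their gaps

m∸n∸1≡m∸1∸n : ∀ m n → m ∸ n ∸ 1 ≡ m ∸ 1 ∸ n
m∸n∸1≡m∸1∸n m n = trans (ℕP.∸-+-assoc m n 1) (trans (cong (m ∸_) (ℕP.+-comm n 1)) (sym (ℕP.∸-+-assoc m 1 n)))

∣m-n∣≡m∸n : ∀ {m n} → n ≤ m → ∣ + m ℤ.- + n ∣ ≡ m ∸ n
∣m-n∣≡m∸n {m} {n} n≤m = cong ∣_∣ (trans (ℤP.m-n≡m⊖n m n) (ℤP.⊖-≥ n≤m))

+suc-+suc : ∀ a b → + suc b ℤ.- + suc a ≡ + b ℤ.- + a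
+suc-+suc a b = trans (ℤP.m-n≡m⊖n (suc b) (suc a)) (trans (ℤP.[1+m]⊖[1+n]≡m⊖n b a) (sym (ℤP.m-n≡m⊖n b a)))

-- shift1 (suc k) is + k
dfacts-shift1 : ∀ N k ks → All (1 ≤_) ks →
                dfacts (N ∸ 1) (+ k) (map shift1 ks) ≡ dfacts N (+ suc k) (map +_ ks)
dfacts-shift1 N k []         []           = cong dfact (ℕP.∸-+-assoc N 1 k)
dfacts-shift1 N k (suc k′ ∷ ks) (s≤s z≤n ∷ 1≤ks) =
  cong₂ _*P_ (cong (λ d → dfact ∣ d ∣) (sym (+suc-+suc k k′))) (dfacts-shift1 N k′ ks 1≤ks)

Linked⇒All-positive : ∀ {y ys} → Linked _<_ (y ∷ ys) → All (1 ≤_) ys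
Linked⇒All-positive {ys = []}    _            = []
Linked⇒All-positive {ys = _ ∷ _} (y<z ∷ y∷ys) =
  All.map (ℕP.≤-trans (s≤s z≤n)) (Linked⇒All ℕP.<-trans y<z y∷ys)

mergeI-∷ʳ : ∀ g r x post → mergeI (g ∷ r ∷ʳ x) post ≡ + x ∷ mergeI (g ∷ r) post
mergeI-∷ʳ g r x [] = cong (λ xs → map +_ xs ++ []) (List.reverse-++ (g ∷ r) (x ∷ []))
mergeI-∷ʳ g r x (h ∷ post) with does (suc g ℕ.≟ h)
... | true  = cong (λ xs → map +_ xs ++ map shift1 (h ∷ post)) (List.reverse-++ r (x ∷ []))
... | false = cong (λ xs → map +_ xs ++ map shift1 (h ∷ post)) (List.reverse-++ (g ∷ r) (x ∷ []))

∷ʳ-nonempty : ∀ (xs : List ℕ) y → ∃₂ λ g r → xs ∷ʳ y ≡ g ∷ r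
∷ʳ-nonempty []       y = y , [] , refl
∷ʳ-nonempty (x ∷ xs) y = x , xs ∷ʳ y , refl

Isup-∷ : ∀ x y I s → Isup (x ∷ y ∷ I) (3 ℕ.+ s) ≡ + x ∷ Isup (y ∷ I) (2 ℕ.+ s)
Isup-∷ x y I s with ∷ʳ-nonempty (reverse (take s I)) y
... | g , r , eq = trans (cong (λ z → mergeI z (drop s I)) rev≡′)
                  (trans (mergeI-∷ʳ g r x (drop s I)) (cong (λ z → + x ∷ mergeI z (drop s I)) (sym rev≡)))
  where
  rev≡ : reverse (y ∷ take s I) ≡ g ∷ r
  rev≡ = trans (List.unfold-reverse y (take s I)) eq
  rev≡′ : reverse (x ∷ y ∷ take s I) ≡ g ∷ r ∷ʳ x
  rev≡′ = trans (List.unfold-reverse x (y ∷ take s I)) (cong (_∷ʳ x) rev≡)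

Isup₂-merge : ∀ x I → Isup (x ∷ suc x ∷ I) 2 ≡ + x ∷ map shift1 I
Isup₂-merge x I rewrite dec-true (suc x ℕ.≟ suc x) refl = refl

Isup₂-split : ∀ x y I → suc x ≢ y → Isup (x ∷ y ∷ I) 2 ≡ + x ∷ map shift1 (y ∷ I)
Isup₂-split x y I 1+x≢y rewrite dec-false (suc x ℕ.≟ y) 1+x≢y = refl

Isup-gap-next : ∀ {n x y I} → x < y → All (1 ≤_) I →
  ∃₂ λ R D → Isup (x ∷ y ∷ I) 2 ≡ + x ∷ R
           × dfacts n (+ x) (map +_ (y ∷ I)) ≋ dfact (y ∸ x) *P D
           × dfacts (n ∸ 1) (+ x) R ≋ dfact (y ∸ x ∸ 1) *P D
Isup-gap-next {n} {x} {suc y} {I} (s≤s x≤y) 1≤I = R , D , Isup≡ , before , after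
  where
  D : Poly
  D = dfacts n (+ suc y) (map +_ I)
  before : dfacts n (+ x) (map +_ (suc y ∷ I)) ≋ dfact (suc y ∸ x) *P D
  before = ≋-reflexive (cong (λ j → dfact j *P D) (∣m-n∣≡m∸n (ℕP.m≤n⇒m≤1+n x≤y)))
  split : Dec (suc x ≡ suc y)
  split = suc x ℕ.≟ suc y
  R : List ℤ
  R with split
  ... | yes _ = map shift1 I  -- i₂ - 1 = i₁ is listed once
  ... | no  _ = map shift1 (suc y ∷ I)
  Isup≡ : Isup (x ∷ suc y ∷ I) 2 ≡ + x ∷ R
  Isup≡ with split
  ... | yes refl  = Isup₂-merge x I
  ... | no 1+x≢1+y = Isup₂-split x (suc y) I 1+x≢1+y
  after : dfacts (n ∸ 1) (+ x) R ≋ dfact (suc y ∸ x ∸ 1) *P D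
  after with split
  ... | yes refl = begin
    dfacts (n ∸ 1) (+ x) (map shift1 I) ≡⟨ dfacts-shift1 n x I 1≤I ⟩
    D                                   ≈⟨ *P-identityˡ D ⟨
    dfact 0 *P D                        ≡⟨ cong (λ j → dfact (j ∸ 1) *P D) (ℕP.m+n∸n≡m 1 x) ⟨
    dfact (suc x ∸ x ∸ 1) *P D          ∎
  ... | no _ = ≋-reflexive (cong₂ _*P_
    (cong dfact (trans (∣m-n∣≡m∸n x≤y) (sym (m∸n∸1≡m∸1∸n (suc y) x))))
    (dfacts-shift1 n y I 1≤I))

Isup-gap : ∀ {n x I} t → Linked _<_ (x ∷ I) → All (_< n) (x ∷ I) → 1 ≤ t → t ≤ length (x ∷ I) →
  ∃₂ λ R D → Isup (x ∷ I) (suc t) ≡ + x ∷ R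
           × dfacts n (+ x) (map +_ I) ≋ dfact (jAt (x ∷ I) n t) *P D
           × dfacts (n ∸ 1) (+ x) R ≋ dfact (jAt (x ∷ I) n t ∸ 1) *P D
Isup-gap {n} {x} {[]} 1 _ _ _ _ =
  [] , oneP , refl , ≋-sym (*P-identityʳ _) ,
  ≋-trans (≋-reflexive (cong dfact (sym (m∸n∸1≡m∸1∸n n x)))) (≋-sym (*P-identityʳ _))
Isup-gap {I = []} (suc (suc t)) _ _ _ (s≤s ())
Isup-gap {I = y ∷ I} 1 (x<y ∷ y∷I) _ _ _ = Isup-gap-next x<y (Linked⇒All-positive y∷I)
Isup-gap {n} {x} {y ∷ I} (suc (suc t)) (_ ∷ y∷I) (_ ∷ y∷I<n) _ (s≤s t<l)
  with Isup-gap (suc t) y∷I y∷I<n (s≤s z≤n) t<l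
... | R , D , Isup≡ , before , after =
  + y ∷ R , gap *P D , trans (Isup-∷ x y I t) (cong (+ x ∷_) Isup≡) , pull j before , pull (j ∸ 1) after
  where
  gap : Poly
  gap = dfact ∣ + y ℤ.- + x ∣
  j : ℕ
  j = jAt (y ∷ I) n (suc t)
  pull : ∀ {p} k → p ≋ dfact k *P D → gap *P p ≋ dfact k *P (gap *P D)
  pull k e = ≋-trans (*P-cong (≋-refl {gap}) e) (*P-swapˡ gap (dfact k) D)

-- Polynomial multiples of a rational function

-- r ≈ c · b is r ≈F c ·F b, wrapped in a record so that r, c and b can be inferred.
infix 4 _≈_·_
record _≈_·_ (r : RatFun) (c : Poly) (b : RatFun) : Set where
  constructor mk≈·
  field cross : num r *P den b ≋ (c *P num b) *P den r

≈·-cong : ∀ {r c c′ b} → c ≋ c′ → r ≈ c · b → r ≈ c′ · b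
≈·-cong {r} {b = b} c≋c′ (mk≈· e) = mk≈· (≋-trans e (*P-congʳ (den r) (*P-congʳ (num b) c≋c′)))

≈·-·F : ∀ {r c b} p → r ≈ c · b → p ·F r ≈ p *P c · b
≈·-·F {r} {c} {b} p (mk≈· e) = mk≈· (begin
  (p *P num r) *P den b         ≈⟨ *P-assoc p (num r) (den b) ⟩
  p *P (num r *P den b)         ≈⟨ *P-cong (≋-refl {p}) e ⟩
  p *P ((c *P num b) *P den r)
    ≈⟨ solve 4 (λ p c nb dr → p :* ((c :* nb) :* dr) := ((p :* c) :* nb) :* dr) ≋-refl p c (num b) (den r) ⟩
  ((p *P c) *P num b) *P den r  ∎)

≈·-+F : ∀ {r₁ r₂ c₁ c₂ b} → r₁ ≈ c₁ · b → r₂ ≈ c₂ · b → r₁ +F r₂ ≈ c₁ +P c₂ · b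
≈·-+F {p₁ / q₁} {p₂ / q₂} {c₁} {c₂} {p / q} (mk≈· e₁) (mk≈· e₂) = mk≈· (begin
  (p₁ *P q₂ +P p₂ *P q₁) *P q
    ≈⟨ solve 5 (λ p₁ q₂ p₂ q₁ q → (p₁ :* q₂ :+ p₂ :* q₁) :* q := (p₁ :* q) :* q₂ :+ (p₂ :* q) :* q₁) ≋-refl p₁ q₂ p₂ q₁ q ⟩
  (p₁ *P q) *P q₂ +P (p₂ *P q) *P q₁
    ≈⟨ +P-cong (*P-congʳ q₂ e₁) (*P-congʳ q₁ e₂) ⟩
  ((c₁ *P p) *P q₁) *P q₂ +P ((c₂ *P p) *P q₂) *P q₁
    ≈⟨ solve 5 (λ c₁ c₂ p q₁ q₂ → ((c₁ :* p) :* q₁) :* q₂ :+ ((c₂ :* p) :* q₂) :* q₁ := ((c₁ :+ c₂) :* p) :* (q₁ :* q₂)) ≋-refl c₁ c₂ p q₁ q₂ ⟩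
  ((c₁ +P c₂) *P p) *P (q₁ *P q₂) ∎)

ΣP : (ℕ → Poly) → ℕ → Poly
ΣP c zero    = []
ΣP c (suc k) = c 0 +P ΣP (λ s → c (suc s)) k

ΣP-telescope : ∀ (A : ℕ → Poly) k → ΣP (λ s → A (suc s) +P negP (A s)) k ≋ A k +P negP (A 0)
ΣP-telescope A zero    = ≋-sym (negP-inverseʳ (A 0))
ΣP-telescope A (suc k) = begin
  (A 1 +P negP (A 0)) +P ΣP (λ s → A (suc (suc s)) +P negP (A (suc s))) k
    ≈⟨ +P-cong (≋-refl {A 1 +P negP (A 0)}) (ΣP-telescope (λ s → A (suc s)) k) ⟩
  (A 1 +P negP (A 0)) +P (A (suc k) +P negP (A 1))
    ≈⟨ solve 3 (λ a₀ a₁ aₖ → (a₁ :- a₀) :+ (aₖ :- a₁) := aₖ :- a₀) ≋-refl (A 0) (A 1) (A (suc k)) ⟩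
  A (suc k) +P negP (A 0) ∎

Δ : (ℕ → Poly) → ℕ → Poly
Δ B zero    = B 0
Δ B (suc s) = B (suc s) +P negP (B s)

ΣP-Δ : ∀ (B : ℕ → Poly) K → ΣP (Δ B) (suc K) ≋ B K
ΣP-Δ B K = begin
  B 0 +P ΣP (λ s → B (suc s) +P negP (B s)) K ≈⟨ +P-cong (≋-refl {B 0}) (ΣP-telescope B K) ⟩
  B 0 +P (B K +P negP (B 0))                  ≈⟨ solve 2 (λ b₀ b → b₀ :+ (b :- b₀) := b) ≋-refl (B 0) (B K) ⟩
  B K                                         ∎

≈·-applyUpTo : ∀ {b} (g : ℕ → RatFun) c k → (∀ s → s < k → g s ≈ c s · b) →
               foldr _+F_ zeroF (applyUpTo g k) ≈ ΣP c k · b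
≈·-applyUpTo g c zero    _ = mk≈· ≋-refl
≈·-applyUpTo g c (suc k) h = ≈·-+F (h 0 (s≤s z≤n))
  (≈·-applyUpTo (λ s → g (suc s)) (λ s → c (suc s)) k (λ s s<k → h (suc s) (s≤s s<k)))

≈·-sumF : ∀ {b} x y g c → (∀ s → s < suc y ∸ x → g (x ℕ.+ s) ≈ c s · b) →
          sumF x y g ≈ ΣP c (suc y ∸ x) · b
≈·-sumF {b} x y g c h = subst (λ rs → foldr _+F_ zeroF rs ≈ ΣP c (suc y ∸ x) · b)
  (sym (List.map-upTo (λ s → g (x ℕ.+ s)) (suc y ∸ x))) (≈·-applyUpTo _ c _ h)

≈·⇒≈F : ∀ {r c p p′ q} → p ≋ c *P p′ → r ≈ c · (p′ / q) → (p / q) ≈F r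
≈·⇒≈F {r} e (mk≈· e′) = coeff-≡ (≋-trans (*P-congʳ (den r) e) (≋-sym e′))

-- The summands

iAt-< : ∀ {n} I → Linked _<_ I → All (_< n) I → ∀ t → 1 ≤ t → t ≤ length I → iAt I n t < iAt I n (suc t)
iAt-< []           _          _          (suc t)       _ ()
iAt-< (x ∷ [])     _          (x<n ∷ []) 1             _ _           = x<n
iAt-< (x ∷ y ∷ I)  (x<y ∷ _)  _          1             _ _           = x<y
iAt-< (x ∷ [])     _          _          (suc (suc t)) _ (s≤s ())
iAt-< (x ∷ y ∷ I)  (_ ∷ y∷I)  (_ ∷ y∷I<n) (suc (suc t)) _ (s≤s t<l) =
  iAt-< (y ∷ I) y∷I y∷I<n (suc t) (s≤s z≤n) t<l

iAt-≤ : ∀ {n} I → All (_< n) I → ∀ t → iAt I n t ≤ n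
iAt-≤ []      _          t             = ℕP.≤-refl
iAt-≤ (x ∷ I) _          zero          = z≤n
iAt-≤ (x ∷ I) (x<n ∷ _)  (suc zero)    = ℕP.<⇒≤ x<n
iAt-≤ (x ∷ I) (_ ∷ I<n)  (suc (suc t)) = iAt-≤ I I<n (suc t)

iAt-end : ∀ {n} I → iAt I n (suc (length I)) ≡ n
iAt-end []          = refl
iAt-end (x ∷ [])    = refl
iAt-end (x ∷ y ∷ I) = iAt-end (y ∷ I)

X^[n∸i] : List ℕ → ℕ → ℕ → Poly
X^[n∸i] I n t = Xpow (n ∸ iAt I n t)

X^[n∸i]-end : ∀ I n → X^[n∸i] I n (suc (length I)) ≡ oneP
X^[n∸i]-end I n = cong Xpow (trans (cong (n ∸_) (iAt-end I)) (ℕP.n∸n≡0 n))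

Xpow-*-u-gap : ∀ {a b n} → a < b → b ≤ n → Xpow (n ∸ b) *P u (b ∸ a) ≋ Xpow (n ∸ b) +P negP (Xpow (n ∸ a))
Xpow-*-u-gap {a} {b} {n} a<b b≤n = ≋-trans (Xpow-*-u (n ∸ b) (ℕP.m<n⇒0<n∸m a<b))
  (+P-cong (≋-refl {Xpow (n ∸ b)}) (scaleP-cong -1ℤ (≋-reflexive (cong Xpow exponent))))
  where
  exponent : n ∸ b ℕ.+ (b ∸ a) ≡ n ∸ a
  exponent = trans (sym (ℕP.+-∸-assoc (n ∸ b) (ℕP.<⇒≤ a<b))) (cong (_∸ a) (ℕP.m∸n+n≡m b≤n))

-- f_{n,I} / (n) for I = x ∷ I
f÷u : ℕ → ℕ → List ℕ → RatFun
f÷u n x I = fact (n ∸ 1) / (fact x *P dfacts n (+ x) (map +_ I))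

Isup-≈ : ∀ {n x I} t g → Linked _<_ (x ∷ I) → All (_< n) (x ∷ I) → 1 ≤ t → t ≤ length (x ∷ I) →
         dfact (jAt (x ∷ I) n t) ≋ g *P dfact (jAt (x ∷ I) n t ∸ 1) →
         f (n ∸ 1) (Isup (x ∷ I) (suc t)) ≈ g · f÷u n x I
Isup-≈ {n} {x} {I} t g x∷I x∷I<n 1≤t t≤l peel with Isup-gap t x∷I x∷I<n 1≤t t≤l
... | R , D , Isup≡ , before , after rewrite Isup≡ = mk≈· (begin
  F *P (fact x *P dfacts n (+ x) (map +_ I))
    ≈⟨ *P-cong (≋-refl {F}) (*P-cong (≋-refl {fact x}) (≋-trans before (*P-congʳ D peel))) ⟩
  F *P (fact x *P ((g *P dfact (j ∸ 1)) *P D))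
    ≈⟨ solve 5 (λ F a g d D → F :* (a :* ((g :* d) :* D)) := (g :* F) :* (a :* (d :* D))) ≋-refl F (fact x) g (dfact (j ∸ 1)) D ⟩
  (g *P F) *P (fact x *P (dfact (j ∸ 1) *P D))
    ≈⟨ *P-cong (≋-refl {g *P F}) (*P-cong (≋-refl {fact x}) after) ⟨
  (g *P F) *P (fact x *P dfacts (n ∸ 1) (+ x) R)  ∎)
  where
  F : Poly
  F = fact (n ∸ 1)
  j : ℕ
  j = jAt (x ∷ I) n t

Isup₁-≈ : ∀ {n a I} → All (1 ≤_) I → f (n ∸ 1) (Isup (suc a ∷ I) 1) ≈ u (suc a) · f÷u n (suc a) I
Isup₁-≈ {n} {a} {I} 1≤I rewrite dfacts-shift1 n a I 1≤I = mk≈· (begin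
  F *P (fact (suc a) *P D)     ≈⟨ *P-cong (≋-refl {F}) (*P-congʳ D (fact-suc a)) ⟩
  F *P ((u (suc a) *P fact a) *P D)
    ≈⟨ solve 4 (λ F g a D → F :* ((g :* a) :* D) := (g :* F) :* (a :* D)) ≋-refl F (u (suc a)) (fact a) D ⟩
  (u (suc a) *P F) *P (fact a *P D) ∎)
  where
  F : Poly
  F = fact (n ∸ 1)
  D : Poly
  D = dfacts n (+ suc a) (map +_ I)

term₀-≈ : ∀ {n x I} → Linked _<_ (x ∷ I) → All (_< n) (x ∷ I) →
          term (x ∷ I) n 0 ≈ X^[n∸i] (x ∷ I) n 1 +P negP (X^[n∸i] (x ∷ I) n 0) · f÷u n x I
term₀-≈ {n} {zero}  _   _         = mk≈· (≋-trans (*P-zeroˡ _ (*P-zeroʳ (Xpow n)))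
  (≋-sym (*P-zeroˡ oneP (*P-zeroˡ (fact (n ∸ 1)) (negP-inverseʳ (Xpow n))))))
term₀-≈ {n} {suc a} x∷I (x<n ∷ _) = ≈·-cong (Xpow-*-u-gap (s≤s z≤n) (ℕP.<⇒≤ x<n))
  (≈·-·F (Xpow (n ∸ suc a)) (Isup₁-≈ (Linked⇒All-positive x∷I)))

module _ {n x I} (x∷I : Linked _<_ (x ∷ I)) (x∷I<n : All (_< n) (x ∷ I)) where

  Isup-odd-≈ : ∀ t → 1 ≤ t → t ≤ length (x ∷ I) → Odd (jAt (x ∷ I) n t) →
               f (n ∸ 1) (Isup (x ∷ I) (suc t)) ≈ oneP · f÷u n x I
  Isup-odd-≈ t 1≤t t≤l odd = Isup-≈ t oneP x∷I x∷I<n 1≤t t≤l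
    (≋-trans (≋-reflexive (dfact-odd odd)) (≋-sym (*P-identityˡ _)))

  term-odd-≈ : ∀ t → 1 ≤ t → t ≤ length (x ∷ I) → Odd (jAt (x ∷ I) n t) →
               term (x ∷ I) n t ≈ X^[n∸i] (x ∷ I) n (suc t) · f÷u n x I
  term-odd-≈ t 1≤t t≤l odd =
    ≈·-cong (*P-identityʳ _) (≈·-·F (X^[n∸i] (x ∷ I) n (suc t)) (Isup-odd-≈ t 1≤t t≤l odd))

  term-even-≈ : ∀ t → 1 ≤ t → t ≤ length (x ∷ I) → ¬ Odd (jAt (x ∷ I) n t) →
                term (x ∷ I) n t ≈ X^[n∸i] (x ∷ I) n (suc t) +P negP (X^[n∸i] (x ∷ I) n t) · f÷u n x I
  term-even-≈ t 1≤t t≤l ¬odd = ≈·-cong (Xpow-*-u-gap i<i′ (iAt-≤ (x ∷ I) x∷I<n (suc t)))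
    (≈·-·F (X^[n∸i] (x ∷ I) n (suc t))
      (Isup-≈ t (u (jAt (x ∷ I) n t)) x∷I x∷I<n 1≤t t≤l (dfact-even (ℕP.m<n⇒0<n∸m i<i′) ¬odd)))
    where
    i<i′ : iAt (x ∷ I) n t < iAt (x ∷ I) n (suc t)
    i<i′ = iAt-< (x ∷ I) x∷I x∷I<n t 1≤t t≤l

  1≤n : 1 ≤ n
  1≤n = ℕP.≤-trans (s≤s z≤n) (All.head x∷I<n)

  even-expansion : (∀ t → 1 ≤ t → t ≤ length (x ∷ I) → ¬ Odd (jAt (x ∷ I) n t)) →
                   f n (map +_ (x ∷ I)) ≈F sumF 0 (length (x ∷ I)) (term (x ∷ I) n)
  even-expansion even =
    ≈·⇒≈F (fact-unfold 1≤n) (≈·-cong telescoped (≈·-sumF 0 l (term (x ∷ I) n) step summand))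
    where
    l : ℕ
    l = length (x ∷ I)
    A : ℕ → Poly
    A = X^[n∸i] (x ∷ I) n
    step : ℕ → Poly
    step s = A (suc s) +P negP (A s)
    summand : ∀ s → s < suc l → term (x ∷ I) n s ≈ step s · f÷u n x I
    summand zero    _         = term₀-≈ x∷I x∷I<n
    summand (suc s) (s≤s s<l) = term-even-≈ (suc s) (s≤s z≤n) s<l (even (suc s) (s≤s z≤n) s<l)
    telescoped : ΣP step (suc l) ≋ oneP +P negP (Xpow n)
    telescoped = ≋-trans (ΣP-telescope A (suc l))
                         (≋-reflexive (cong (_+P negP (Xpow n)) (X^[n∸i]-end (x ∷ I) n)))

  odd-expansion : ∀ m → 1 ≤ m → m ≤ length (x ∷ I) → Odd (jAt (x ∷ I) n m) →
                  (∀ t → m < t → t ≤ length (x ∷ I) → ¬ Odd (jAt (x ∷ I) n t)) →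
                  f n (map +_ (x ∷ I)) ≈F (negP (Xpow n) ·F f (n ∸ 1) (Isup (x ∷ I) (suc m)))
                                          +F sumF m (length (x ∷ I)) (term (x ∷ I) n)
  odd-expansion m 1≤m m≤l odd evenAfter = ≈·⇒≈F (fact-unfold 1≤n) (≈·-cong telescoped
    (≈·-+F (≈·-·F (negP (Xpow n)) (Isup-odd-≈ m 1≤m m≤l odd))
           (≈·-sumF m l (term (x ∷ I) n) (Δ B) summand)))
    where
    l : ℕ
    l = length (x ∷ I)
    B : ℕ → Poly
    B s = X^[n∸i] (x ∷ I) n (suc (m ℕ.+ s))
    summand : ∀ s → s < suc l ∸ m → term (x ∷ I) n (m ℕ.+ s) ≈ Δ B s · f÷u n x I
    summand zero    _  = subst (λ t → term (x ∷ I) n t ≈ X^[n∸i] (x ∷ I) n (suc t) · f÷u n x I)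
                               (sym (ℕP.+-identityʳ m)) (term-odd-≈ m 1≤m m≤l odd)
    summand (suc s) s< =
      ≈·-cong (+P-cong (≋-refl {B (suc s)}) (scaleP-cong -1ℤ (≋-reflexive (cong A (ℕP.+-suc m s)))))
      (term-even-≈ t (ℕP.≤-trans 1≤m (ℕP.m≤m+n m (suc s))) t≤l (evenAfter t (ℕP.m<m+n m (s≤s z≤n)) t≤l))
      where
      A : ℕ → Poly
      A = X^[n∸i] (x ∷ I) n
      t : ℕ
      t = m ℕ.+ suc s
      t≤l : t ≤ l
      t≤l = ℕP.≤-pred (subst (suc t ≤_) (ℕP.m+[n∸m]≡n (ℕP.m≤n⇒m≤1+n m≤l)) (ℕP.+-monoʳ-< m s<))
    X : Poly
    X = Xpow n
    telescoped : negP X *P oneP +P ΣP (Δ B) (suc l ∸ m) ≋ oneP +P negP X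
    telescoped = begin
      negP X *P oneP +P ΣP (Δ B) (suc l ∸ m)
        ≡⟨ cong (λ k → negP X *P oneP +P ΣP (Δ B) k) (ℕP.+-∸-assoc 1 m≤l) ⟩
      negP X *P oneP +P ΣP (Δ B) (suc (l ∸ m)) ≈⟨ +P-cong (≋-refl {negP X *P oneP}) (ΣP-Δ B (l ∸ m)) ⟩
      negP X *P oneP +P B (l ∸ m)
        ≡⟨ cong (λ k → negP X *P oneP +P X^[n∸i] (x ∷ I) n (suc k)) (ℕP.m+[n∸m]≡n m≤l) ⟩
      negP X *P oneP +P X^[n∸i] (x ∷ I) n (suc l) ≡⟨ cong (negP X *P oneP +P_) (X^[n∸i]-end (x ∷ I) n) ⟩
      negP X *P oneP +P oneP
        ≈⟨ solve 1 (λ x → (:- x) :* con 1ℤ :+ con 1ℤ := con 1ℤ :- x) ≋-refl X ⟩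
      oneP +P negP X                           ∎

f-∅-expansion : ∀ n → f n [] ≈F sumF 0 0 (term [] n)
f-∅-expansion n = ≈·⇒≈F (≋-sym (*P-identityˡ oneP))
  (≈·-cong sum≋1 (≈·-sumF 0 0 (term [] n) (λ _ → X⁰ *P oneP) summand))
  where
  X⁰ : Poly
  X⁰ = Xpow (n ∸ n)
  summand : ∀ s → s < 1 → term [] n (0 ℕ.+ s) ≈ X⁰ *P oneP · (oneP / oneP)
  summand zero    _             = ≈·-·F X⁰ (mk≈· (≋-sym (*P-identityʳ _)))
  summand (suc s) (s≤s ())
  sum≋1 : X⁰ *P oneP +P [] ≋ oneP
  sum≋1 = ≋-trans (≋-reflexive (+P-identityʳ _))
            (≋-trans (*P-identityʳ X⁰) (≋-reflexive (cong Xpow (ℕP.n∸n≡0 n))))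

theorem3p3 : (n : ℕ) → 1 ≤ n → (I : List ℕ) → Linked _<_ I → All (_< n) I →
  ((m : ℕ) → 1 ≤ m → m ≤ length I → Odd (jAt I n m) →
    ((t : ℕ) → m < t → t ≤ length I → ¬ Odd (jAt I n t)) →
    f n (map +_ I) ≈F (negP (Xpow n) ·F f (n ∸ 1) (Isup I (suc m))) +F sumF m (length I) (term I n))
  × (((t : ℕ) → 1 ≤ t → t ≤ length I → ¬ Odd (jAt I n t)) →
    f n (map +_ I) ≈F sumF 0 (length I) (term I n))
theorem3p3 n _ []      _   _     = (λ { zero () ; (suc _) _ () }) , λ _ → f-∅-expansion n
theorem3p3 n _ (x ∷ I) x∷I x∷I<n = odd-expansion x∷I x∷I<n , even-expansion x∷I x∷I<n
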